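{- Let $F=\coprod_{i\in I}\hom(X_i,-):\mathbf{Set}\to\mathbf{Set}$ for a non-empty family of sets $(X_i)_{i\in I}$, let $\alpha^s:F\times F\to F$ be the natural transformation corresponding to an element $s=(s_{ij})_{i,j\in I}\in\prod_{i,j\in I}F(X_i+X_j)$, and let $u:\underline{1}\to F$ be a natural transformation, which takes all its values in the summand $\hom(X_k,-)$ for an index $k\in I$ with $X_k=\emptyset$. Then $u$ is a unit for $\alpha^s$ if and only if for every $i\in I$, \[ \mathrm{id}_{X_i}=m\circ s_{ik}=n\circ s_{ki}:X_i\to X_i, \] (with $s_{ik}$, $s_{ki}$ maps $X_i\to X_i+\emptyset$, $X_i\to\emptyset+X_i$ in the $i$-th summand), where $m:X_i+\emptyset\to X_i$ and $n:\emptyset+X_i\to X_i$ are the canonical isomorphisms.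
   Context: $\underline{1}$ is the constant functor with value a one-element set $1=\{\ast\}$. Every natural transformation $\underline{1}\to F$ factors through the inclusion of a summand $\hom(X_k,-)\to F$ with $X_k=\emptyset$. An element $s_{ij}\in F(X_i+X_j)$ is a pair consisting of an index $k\in I$ and a map $X_k\to X_i+X_j$; $\alpha^s_Y(a,b)=F[a,b](s_{ij})$ for $(a,b)\in\hom(X_i,Y)\times\hom(X_j,Y)$, and every natural transformation $F\times F\to F$ is of this form for a unique $s$. $u$ is a unit for $\alpha$ if for every set $X$ and every map $a:X\to FX$, $\alpha_X\circ\langle a,u_X\circ!_X\rangle=a=\alpha_X\circ\langle u_X\circ!_X,a\rangle$, where $!_X:X\to1$. -}

module Defs where

open import Data.Empty using (⊥; ⊥-elim)
open import Data.Unit using (⊤; tt)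
open import Data.Sum using (_⊎_; inj₁; inj₂; [_,_])
open import Data.Product using (Σ; _×_; _,_; proj₁; proj₂)
open import Function using (_∘_; id)
open import Relation.Binary.PropositionalEquality using (_≡_; subst; sym)

module _ {I : Set} (X : I → Set) where

  F : Set → Set
  F Y = Σ I (λ i → X i → Y)

  Fmap : {Y Z : Set} → (Y → Z) → F Y → F Z
  Fmap f (i , g) = i , f ∘ g

  -- Equality of elements of F Y: same summand, and the maps agree
  -- pointwise (extensional equality of maps, as in Set).
  _≈F_ : {Y : Set} → F Y → F Y → Set
  _≈F_ (i , g) (j , h) = Σ (i ≡ j) (λ p → ∀ x → g x ≡ h (subst X p x))

  Elt : Set
  Elt = (i j : I) → F (X i ⊎ X j)

  α : Elt → (Y : Set) → F Y × F Y → F Y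
  α s Y ((i , a) , (j , b)) = Fmap [ a , b ] (s i j)

  NatFrom1 : Set₁
  NatFrom1 = Σ ((Y : Set) → ⊤ → F Y) λ u →
    {Y Z : Set} (f : Y → Z) → Fmap f (u Y tt) ≈F u Z tt

  -- u is a unit for μ : F × F → F: for every set Y and every a : Y → F Y,
  -- μ_Y ∘ ⟨a , u_Y ∘ !_Y⟩ = a = μ_Y ∘ ⟨u_Y ∘ !_Y , a⟩ (maps compared pointwise)
  IsUnit : ((Y : Set) → F Y × F Y → F Y) → ((Y : Set) → ⊤ → F Y) → Set₁
  IsUnit μ u = (Y : Set) (a : Y → F Y) (y : Y) →
    (μ Y (a y , u Y tt) ≈F a y) × (μ Y (u Y tt , a y) ≈F a y)

  m-iso : {i k : I} → (X k → ⊥) → X i ⊎ X k → X i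
  m-iso e = [ id , (λ x → ⊥-elim (e x)) ]

  n-iso : {i k : I} → (X k → ⊥) → X k ⊎ X i → X i
  n-iso e = [ (λ x → ⊥-elim (e x)) , id ]

  -- "id_{X_i} = m ∘ s_ik": s_ik lies in the i-th summand (so it is a map
  -- X_i → X_i + ∅) and m composed with it is the identity on X_i.
  LeftCond : Elt → (k : I) → (X k → ⊥) → I → Set
  LeftCond s k e i = Σ (proj₁ (s i k) ≡ i) λ p →
    ∀ (x : X i) → m-iso e (proj₂ (s i k) (subst X (sym p) x)) ≡ x

  RightCond : Elt → (k : I) → (X k → ⊥) → I → Set
  RightCond s k e i = Σ (proj₁ (s k i) ≡ i) λ p →
    ∀ (x : X i) → n-iso e (proj₂ (s k i) (subst X (sym p) x)) ≡ x

-- Since X k is empty, any copairing [ f , g ] out of X i ⊎ X k agrees pointwise with f ∘ m,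
-- so α((i , f) , (k , g)) = F(f ∘ m)(s_ik).  This is (i , f) for every f exactly when s_ik
-- lies in the i-th summand and m ∘ s_ik = id: testing f = ! : X i → 1 pins down the summand,
-- and testing f = id on every point gives the identity.  The right unit law is symmetric.
module Submission where

open import Defs
open import Data.Empty using (⊥; ⊥-elim)
open import Data.Unit using (⊤; tt)
open import Data.Sum using (_⊎_; inj₁; inj₂; [_,_])
open import Data.Product using (Σ; Σ-syntax; _×_; _,_; proj₁; proj₂)
open import Function using (id; const)
open import Function.Bundles using (_⇔_; mk⇔)
open import Relation.Binary.PropositionalEquality
  using (_≡_; refl; sym; trans; cong; subst)

module _ {A B Y : Set} (e : B → ⊥) (f : A → Y) (g : B → Y) where

  [,]-emptyʳ : ∀ w → [ f , g ] w ≡ f ([ id , (λ b → ⊥-elim (e b)) ] w)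
  [,]-emptyʳ (inj₁ a) = refl
  [,]-emptyʳ (inj₂ b) = ⊥-elim (e b)

  [,]-emptyˡ : ∀ w → [ g , f ] w ≡ f ([ (λ b → ⊥-elim (e b)) , id ] w)
  [,]-emptyˡ (inj₁ b) = ⊥-elim (e b)
  [,]-emptyˡ (inj₂ a) = refl

module _ {I : Set} (X : I → Set) where

  SplitBy : {i : I} {B : Set} → (B → X i) → F X B → Set
  SplitBy {i} r c = Σ (proj₁ c ≡ i) λ p → ∀ x → r (proj₂ c (subst X (sym p) x)) ≡ x

  split⇒Fmap≈ : {i : I} {B Y : Set} (r : B → X i) (c : F X B) → SplitBy r c →
    (f : X i → Y) (h : B → Y) → (∀ b → h b ≡ f (r b)) → _≈F_ X (Fmap X h c) (i , f)
  split⇒Fmap≈ r (_ , c) (refl , r∘c≡id) f h h≗f∘r =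
    refl , λ x → trans (h≗f∘r (c x)) (cong f (r∘c≡id x))

  Fmap≈⇒split : {i : I} {B : Set} (r h : B → X i) → (∀ b → h b ≡ r b) → (c : F X B) →
    proj₁ c ≡ i → (X i → _≈F_ X (Fmap X h c) (i , id)) → SplitBy r c
  Fmap≈⇒split r h h≗r (_ , c) refl h∘c≈id = refl , λ x → r∘c≡id x (h∘c≈id x)
    where
    r∘c≡id : ∀ x → _≈F_ X (Fmap X h (_ , c)) (_ , id) → r (c x) ≡ x
    r∘c≡id x (refl , h∘c≡id) = trans (sym (h≗r (c x))) (h∘c≡id x)

  inSummand : {k : I} {Y : Set} (v : F X Y) → proj₁ v ≡ k → Σ[ g ∈ (X k → Y) ] v ≡ (k , g)
  inSummand (_ , g) refl = g , refl

proposition5p5 : {I : Set} (X : I → Set) (i₀ : I) (s : Elt X)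
    (u : NatFrom1 X) (k : I) (e : X k → ⊥)
    (u-in-k : (Y : Set) → proj₁ (proj₁ u Y tt) ≡ k) →
    IsUnit X (α X s) (proj₁ u) ⇔ ((i : I) → LeftCond X s k e i × RightCond X s k e i)
proposition5p5 {I} X _ s u k e u-in-k = mk⇔ unit⇒conds conds⇒unit
  where
  g : (Y : Set) → X k → Y
  g Y = proj₁ (inSummand X (proj₁ u Y tt) (u-in-k Y))

  u≡g : (Y : Set) → proj₁ u Y tt ≡ (k , g Y)
  u≡g Y = proj₂ (inSummand X (proj₁ u Y tt) (u-in-k Y))

  unit⇒conds : IsUnit X (α X s) (proj₁ u) → (i : I) → LeftCond X s k e i × RightCond X s k e i
  unit⇒conds U i =
      Fmap≈⇒split X _ [ id , g (X i) ] ([,]-emptyʳ e id (g (X i))) (s i k)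
        (proj₁ (leftLaw ⊤ (const tt) tt)) (leftLaw (X i) id)
    , Fmap≈⇒split X _ [ g (X i) , id ] ([,]-emptyˡ e id (g (X i))) (s k i)
        (proj₁ (rightLaw ⊤ (const tt) tt)) (rightLaw (X i) id)
    where
    leftLaw : (Y : Set) (f : X i → Y) → Y → _≈F_ X (α X s Y ((i , f) , (k , g Y))) (i , f)
    leftLaw Y f y = subst (λ v → _≈F_ X (α X s Y ((i , f) , v)) (i , f)) (u≡g Y)
      (proj₁ (U Y (const (i , f)) y))

    rightLaw : (Y : Set) (f : X i → Y) → Y → _≈F_ X (α X s Y ((k , g Y) , (i , f))) (i , f)
    rightLaw Y f y = subst (λ v → _≈F_ X (α X s Y (v , (i , f))) (i , f)) (u≡g Y)
      (proj₂ (U Y (const (i , f)) y))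

  conds⇒unit : ((i : I) → LeftCond X s k e i × RightCond X s k e i) → IsUnit X (α X s) (proj₁ u)
  conds⇒unit C Y a y rewrite u≡g Y =
      split⇒Fmap≈ X _ (s i k) (proj₁ (C i)) f [ f , g Y ] ([,]-emptyʳ e f (g Y))
    , split⇒Fmap≈ X _ (s k i) (proj₂ (C i)) f [ g Y , f ] ([,]-emptyˡ e f (g Y))
    where
    i = proj₁ (a y)
    f = proj₂ (a y)
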